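{- Let $D$ be any digraph without symmetric arcs (no pair of arcs $uv,vu$). Then $\gamma_{os}(D)\le\gamma^+(D)+\gamma^-(D)$.
   Context: Digraphs $D=(V,A)$ are finite, without loops or multiple arcs. The underlying graph $G$ of $D$ has vertex set $V$, with $u,v$ adjacent iff $uv\in A$ or $vu\in A$. $S\subseteq V$ is out-dominating if every $v\in V\setminus S$ has an in-neighbor in $S$, and in-dominating if every $v\in V\setminus S$ has an out-neighbor in $S$; $\gamma^+(D)$ and $\gamma^-(D)$ are the minimum sizes of such sets. $S$ is dominating in $G$ if every vertex outside $S$ has a neighbor in $S$. $S$ is an out-secure dominating set (OSDS) of $D$ if $S$ is dominating in $G$ and for every $v\in V\setminus S$ there is an in-neighbor $u\in S$ of $v$ such that $(S\setminus\{u\})\cup\{v\}$ is dominating in $G$; $\gamma_{os}(D)$ is the minimum size of an OSDS. -}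

module Defs where

open import Data.Nat using (ℕ; _≤_)
open import Data.Fin using (Fin)
open import Data.Fin.Subset using (Subset; _∈_; _∉_; ∣_∣; _-_; _∪_; ⁅_⁆)
open import Data.Product using (Σ; ∃; _×_)
open import Data.Sum using (_⊎_)
open import Relation.Binary.PropositionalEquality using (_≡_)
open import Relation.Nullary using (¬_)
open import Level using (0ℓ; suc)

record Digraph (n : ℕ) : Set₁ where
  field
    Arc   : Fin n → Fin n → Set
    loopless : ∀ v → ¬ Arc v v

open Digraph public

NoSymmetricArcs : ∀ {n} → Digraph n → Set
NoSymmetricArcs D = ∀ u v → Arc D u v → ¬ Arc D v u

Adj : ∀ {n} → Digraph n → Fin n → Fin n → Set
Adj D u v = Arc D u v ⊎ Arc D v u

Dominating : ∀ {n} → Digraph n → Subset n → Set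
Dominating D S = ∀ v → v ∉ S → ∃ λ u → u ∈ S × Adj D u v

OutDominating : ∀ {n} → Digraph n → Subset n → Set
OutDominating D S = ∀ v → v ∉ S → ∃ λ u → u ∈ S × Arc D u v

InDominating : ∀ {n} → Digraph n → Subset n → Set
InDominating D S = ∀ v → v ∉ S → ∃ λ u → u ∈ S × Arc D v u

OSDS : ∀ {n} → Digraph n → Subset n → Set
OSDS D S =
  Dominating D S ×
  (∀ v → v ∉ S → ∃ λ u → u ∈ S × Arc D u v × Dominating D ((S - u) ∪ ⁅ v ⁆))

IsMinSize : ∀ {n} → (Subset n → Set) → ℕ → Set
IsMinSize P k = (∃ λ S → P S × ∣ S ∣ ≡ k) × (∀ S → P S → k ≤ ∣ S ∣)

IsGammaOut IsGammaIn IsGammaOS : ∀ {n} → Digraph n → ℕ → Set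
IsGammaOut D = IsMinSize (OutDominating D)
IsGammaIn D = IsMinSize (InDominating D)
IsGammaOS D = IsMinSize (OSDS D)

-- If S⁺ is out-dominating and S⁻ is in-dominating, then S = S⁺ ∪ S⁻ is both, and it is
-- out-secure: a vertex v ∉ S is defended by any in-neighbour u ∈ S. After swapping u for v,
-- u is dominated by v, and every other w ∉ S keeps a neighbour in S - u, because its
-- in-neighbour and its out-neighbour in S cannot both be u without a symmetric pair uw, wu.
module Submission where

open import Defs
open import Data.Nat using (ℕ; _≤_; _+_; s≤s; z≤n)
open import Data.Nat.Properties using (≤-trans; ≤-reflexive; +-suc; +-monoʳ-≤; n≤1+n)
open import Data.Fin.Properties using (_≟_)
open import Data.Fin.Subset using (Subset; _∈_; _∉_; _⊆_; ∣_∣; _-_; _∪_; ⁅_⁆; inside; outside)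
open import Data.Fin.Subset.Properties using (p⊆p∪q; q⊆p∪q; x∈p∪q⁺; x∈⁅x⁆; x∈p∧x≢y⇒x∈p-y)
open import Data.Vec using ([]; _∷_)
open import Data.Product using (_,_)
open import Data.Sum using (inj₁; inj₂)
open import Relation.Binary.PropositionalEquality using (refl; sym)
open import Relation.Nullary using (yes; no; contradiction)

∣p∪q∣≤∣p∣+∣q∣ : ∀ {n} (p q : Subset n) → ∣ p ∪ q ∣ ≤ ∣ p ∣ + ∣ q ∣
∣p∪q∣≤∣p∣+∣q∣ []            []            = z≤n
∣p∪q∣≤∣p∣+∣q∣ (outside ∷ p) (outside ∷ q) = ∣p∪q∣≤∣p∣+∣q∣ p q
∣p∪q∣≤∣p∣+∣q∣ (outside ∷ p) (inside  ∷ q) =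
  ≤-trans (s≤s (∣p∪q∣≤∣p∣+∣q∣ p q)) (≤-reflexive (sym (+-suc ∣ p ∣ ∣ q ∣)))
∣p∪q∣≤∣p∣+∣q∣ (inside  ∷ p) (outside ∷ q) = s≤s (∣p∪q∣≤∣p∣+∣q∣ p q)
∣p∪q∣≤∣p∣+∣q∣ (inside  ∷ p) (inside  ∷ q) =
  s≤s (≤-trans (∣p∪q∣≤∣p∣+∣q∣ p q) (+-monoʳ-≤ ∣ p ∣ (n≤1+n ∣ q ∣)))

module _ {n} (D : Digraph n) where

  OutDominating-mono : ∀ {S T} → S ⊆ T → OutDominating D S → OutDominating D T
  OutDominating-mono S⊆T od v v∉T with od v (λ v∈S → v∉T (S⊆T v∈S))
  ... | u , u∈S , uv = u , S⊆T u∈S , uv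

  InDominating-mono : ∀ {S T} → S ⊆ T → InDominating D S → InDominating D T
  InDominating-mono S⊆T ind v v∉T with ind v (λ v∈S → v∉T (S⊆T v∈S))
  ... | u , u∈S , vu = u , S⊆T u∈S , vu

  OutDominating⇒Dominating : ∀ {S} → OutDominating D S → Dominating D S
  OutDominating⇒Dominating od v v∉S with od v v∉S
  ... | u , u∈S , uv = u , u∈S , inj₁ uv

  module _ {S : Subset n} (nsym : NoSymmetricArcs D)
           (od : OutDominating D S) (ind : InDominating D S) where

    swap-Dominating : ∀ {u v} → u ∈ S → Arc D u v → Dominating D ((S - u) ∪ ⁅ v ⁆)
    swap-Dominating {u} {v} u∈S uv w w∉S′ with w ≟ u
    ... | yes refl = v , x∈p∪q⁺ (inj₂ (x∈⁅x⁆ v)) , inj₂ uv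
    ... | no w≢u with od w w∉S | ind w w∉S
      where
      w∉S : w ∉ S
      w∉S w∈S = w∉S′ (x∈p∪q⁺ (inj₁ (x∈p∧x≢y⇒x∈p-y w∈S w≢u)))
    ...   | x , x∈S , xw | y , y∈S , wy with x ≟ u | y ≟ u
    ...     | no x≢u   | _        = x , x∈p∪q⁺ (inj₁ (x∈p∧x≢y⇒x∈p-y x∈S x≢u)) , inj₁ xw
    ...     | yes refl | no y≢u   = y , x∈p∪q⁺ (inj₁ (x∈p∧x≢y⇒x∈p-y y∈S y≢u)) , inj₂ wy
    ...     | yes refl | yes refl = contradiction wy (nsym u w xw)

    OutDominating∧InDominating⇒OSDS : OSDS D S
    OutDominating∧InDominating⇒OSDS =
        OutDominating⇒Dominating od
      , λ v v∉S → let (u , u∈S , uv) = od v v∉S in u , u∈S , uv , swap-Dominating u∈S uv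

theorem3p7 : ∀ {n} (D : Digraph n) → NoSymmetricArcs D →
    ∀ (gos gout gin : ℕ) → IsGammaOS D gos → IsGammaOut D gout → IsGammaIn D gin →
      gos ≤ gout + gin
theorem3p7 D nsym gos gout gin (_ , gos-min) ((S⁺ , od , refl) , _) ((S⁻ , ind , refl) , _) =
  ≤-trans (gos-min (S⁺ ∪ S⁻) S-isOSDS) (∣p∪q∣≤∣p∣+∣q∣ S⁺ S⁻)
  where
  S-isOSDS : OSDS D (S⁺ ∪ S⁻)
  S-isOSDS = OutDominating∧InDominating⇒OSDS D nsym
    (OutDominating-mono D (p⊆p∪q S⁻) od)
    (InDominating-mono D (q⊆p∪q S⁺ S⁻) ind)
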